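{- Let $t\ge 2$ and $n\ge 3$ be integers. Then for any integers $\ell,\ell'$ with $2\le \ell,\ell'\le n$, the graph $P_{\ell t}\Diamond_\ell K_n$ is isomorphic to $P_{\ell' t}\Diamond_{\ell'} K_n$.
   Context: $P_m$ denotes the path $v_1\cdots v_m$ and $K_n$ the complete graph on $n$ vertices. Path-aligned product: for positive integers $\ell\mid m$ and a connected vertex-transitive graph $G$ containing $P_\ell$ as a subgraph, $P_m\Diamond_\ell G$ is formed from the path $P_m=v_1\cdots v_m$ and $m/\ell$ pairwise disjoint copies of $G$, where for each $1\le i\le m/\ell$ the consecutive path vertices $v_{(i-1)\ell+1},\ldots,v_{i\ell}$ are identified, in order, with the vertices of a path $P_\ell$ in the $i$-th copy of $G$ (for $G=K_n$, these are any $\ell$ distinct vertices of the copy, taken in some order). Consecutive copies are joined only by the path edges $v_{i\ell}v_{i\ell+1}$. -}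

module Defs where

open import Level using (0ℓ)
open import Data.Nat using (ℕ; zero; suc; _∸_)
open import Data.Fin using (Fin; toℕ)
open import Data.Product using (Σ; _×_; _,_)
open import Data.Sum using (_⊎_)
open import Relation.Nullary using (¬_)
open import Relation.Binary.PropositionalEquality using (_≡_)
open import Function.Bundles using (_↔_; _⇔_; Inverse)

record Graph : Set₁ where
  field
    V   : Set
    Adj : V → V → Set
open Graph public

_≅_ : Graph → Graph → Set
G ≅ H = Σ (V G ↔ V H) λ f →
          ∀ u v → Adj G u v ⇔ Adj H (Inverse.to f u) (Inverse.to f v)

-- Vertices: t disjoint copies of K_n, vertex (i , x) = vertex x of the i-th copy.
-- emb i : Fin ℓ → Fin n lists (in order) the vertices of copy i identified with the
-- path vertices v_{iℓ+1}, …, v_{iℓ+ℓ} (0-indexed copies; should be injective).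
-- Edges: all edges of each copy of K_n, plus the path edges joining the last
-- path vertex of copy i (position ℓ-1) to the first path vertex of copy i+1
-- (position 0).  Path edges inside a copy are already edges of K_n.
module _ (t n ℓ : ℕ) (emb : Fin t → Fin ℓ → Fin n) where

  PAVertex : Set
  PAVertex = Fin t × Fin n

  InCopy : PAVertex → PAVertex → Set
  InCopy (i , x) (j , y) = (i ≡ j) × ¬ (x ≡ y)

  Link : PAVertex → PAVertex → Set
  Link (i , x) (j , y) =
    (toℕ j ≡ suc (toℕ i)) ×
    (Σ (Fin ℓ) λ a → (toℕ a ≡ ℓ ∸ 1) × (x ≡ emb i a)) ×
    (Σ (Fin ℓ) λ b → (toℕ b ≡ 0) × (y ≡ emb j b))

  PathAligned : Graph
  PathAligned = record
    { V   = PAVertex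
    ; Adj = λ u v → InCopy u v ⊎ (Link u v ⊎ Link v u)
    }

{-# OPTIONS --safe #-}
module Submission where

-- Outside its own copy of K_n, the i-th copy meets the rest of the graph only through
-- its first and last path vertices, so P_{ℓt} ◇_ℓ K_n is determined up to isomorphism
-- by the chain of t cliques in which copy i is entered at e i 0 and left at e i (ℓ-1).
-- For ℓ ≥ 2 these are two distinct vertices of K_n, and any two ordered pairs of
-- distinct vertices are related by a permutation of K_n; applying one such permutation
-- per copy is an isomorphism between the two chains.

open import Defs
open import Level using (0ℓ) renaming (suc to lsuc)
open import Data.Nat using (ℕ; _≤_; suc; s≤s)
open import Data.Fin using (Fin; toℕ; zero; fromℕ)
open import Data.Fin.Properties using (_≟_; toℕ-injective; toℕ-fromℕ)
open import Data.Fin.Permutation using (Permutation′; _⟨$⟩ʳ_; _∘ₚ_; transpose)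
open import Data.Product using (Σ-syntax; _×_; _,_; proj₁; proj₂)
open import Data.Product.Function.NonDependent.Propositional using (_×-⇔_)
open import Data.Sum using (_⊎_)
open import Data.Sum.Function.Propositional using (_⊎-⇔_)
open import Function using (_∘_)
open import Function.Bundles using (_↔_; _⇔_; Inverse; Injection; mk⇔; mk↔ₛ′)
open import Function.Properties.Inverse using (↔⇒↣)
open import Function.Construct.Composition using (_⇔-∘_; _↔-∘_)
open import Function.Construct.Identity using (⇔-id; ↔-id)
open import Function.Construct.Symmetry using (⇔-sym; ↔-sym)
open import Function.Definitions using (Injective)
open import Relation.Binary.PropositionalEquality
  using (_≡_; _≢_; refl; sym; trans; cong; subst; subst₂)
open import Relation.Binary.Bundles using (Setoid)
open import Relation.Binary.Definitions using (Reflexive; Symmetric; Transitive)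
import Relation.Binary.Reasoning.Setoid as SetoidReasoning
open import Relation.Nullary.Decidable using (dec-true; dec-false)

≅-refl : Reflexive _≅_
≅-refl = ↔-id _ , λ u v → ⇔-id _

≅-sym : Symmetric _≅_
≅-sym {G} {H} (f , f-adj) = ↔-sym f , λ u v →
  ⇔-sym (subst₂ (λ u′ v′ → Adj G (from u) (from v) ⇔ Adj H u′ v′)
                (strictlyInverseˡ u) (strictlyInverseˡ v)
                (f-adj (from u) (from v)))
  where open Inverse f

≅-trans : Transitive _≅_
≅-trans (f , f-adj) (g , g-adj) =
  g ↔-∘ f , λ u v → g-adj (Inverse.to f u) (Inverse.to f v) ⇔-∘ f-adj u v

≅-setoid : Setoid (lsuc 0ℓ) 0ℓ
≅-setoid = record
  { Carrier       = Graph
  ; _≈_           = _≅_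
  ; isEquivalence = record
    { refl  = ≅-refl
    ; sym   = ≅-sym
    -- _≅_ unfolds to a Σ-type, from which the middle graph cannot be inferred
    ; trans = λ {G H K} → ≅-trans {G} {H} {K}
    }
  }

module _ {n : ℕ} where

  ⟨$⟩ʳ-injective : (π : Permutation′ n) → Injective _≡_ _≡_ (π ⟨$⟩ʳ_)
  ⟨$⟩ʳ-injective π = Injection.injective (↔⇒↣ π)

  transpose-mapsˡ : (i j : Fin n) → transpose i j ⟨$⟩ʳ i ≡ j
  transpose-mapsˡ i j rewrite dec-true (i ≟ i) refl = refl

  transpose-fixes : (i j k : Fin n) → k ≢ i → k ≢ j → transpose i j ⟨$⟩ʳ k ≡ k
  transpose-fixes i j k k≢i k≢j rewrite dec-false (k ≟ i) k≢i | dec-false (k ≟ j) k≢j = refl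

  permutation-mapping-pair : {a b a′ b′ : Fin n} → a ≢ b → a′ ≢ b′ →
    Σ[ π ∈ Permutation′ n ] (π ⟨$⟩ʳ a ≡ a′) × (π ⟨$⟩ʳ b ≡ b′)
  permutation-mapping-pair {a} {b} {a′} {b′} a≢b a′≢b′ =
    τ ∘ₚ transpose c b′ ,
    trans (cong (transpose c b′ ⟨$⟩ʳ_) (transpose-mapsˡ a a′))
          (transpose-fixes c b′ a′ a′≢c a′≢b′) ,
    transpose-mapsˡ c b′
    where
    τ = transpose a a′
    c = τ ⟨$⟩ʳ b
    a′≢c : a′ ≢ c
    a′≢c a′≡c = a≢b (⟨$⟩ʳ-injective τ (trans (transpose-mapsˡ a a′) a′≡c))

  ⟨$⟩ʳ-≡-⇔ : (π : Permutation′ n) {a a′ x : Fin n} → π ⟨$⟩ʳ a ≡ a′ →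
    (x ≡ a) ⇔ (π ⟨$⟩ʳ x ≡ a′)
  ⟨$⟩ʳ-≡-⇔ π πa≡a′ = mk⇔ (λ { refl → πa≡a′ })
                          (λ πx≡a′ → ⟨$⟩ʳ-injective π (trans πx≡a′ (sym πa≡a′)))

Σ-toℕ≡-⇔ : ∀ {m p} {P : Fin m → Set} (c : Fin m) → toℕ c ≡ p →
  (Σ[ a ∈ Fin m ] (toℕ a ≡ p) × P a) ⇔ P c
Σ-toℕ≡-⇔ {P = P} c c≡p = mk⇔
  (λ { (a , a≡p , Pa) → subst P (toℕ-injective (trans a≡p (sym c≡p))) Pa })
  (λ Pc → c , c≡p , Pc)

module _ (t n : ℕ) where

  SameCopy : Fin t × Fin n → Fin t × Fin n → Set
  SameCopy (i , x) (j , y) = (i ≡ j) × (x ≢ y)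

  Bridge : (entry exit : Fin t → Fin n) → Fin t × Fin n → Fin t × Fin n → Set
  Bridge entry exit (i , x) (j , y) = (toℕ j ≡ suc (toℕ i)) × (x ≡ exit i) × (y ≡ entry j)

  CliqueChain : (entry exit : Fin t → Fin n) → Graph
  CliqueChain entry exit = record
    { V   = Fin t × Fin n
    ; Adj = λ u v → SameCopy u v ⊎ (Bridge entry exit u v ⊎ Bridge entry exit v u)
    }

  cliqueChain-≅ : {f l f′ l′ : Fin t → Fin n} →
    (∀ i → Σ[ π ∈ Permutation′ n ] (π ⟨$⟩ʳ f i ≡ f′ i) × (π ⟨$⟩ʳ l i ≡ l′ i)) →
    CliqueChain f l ≅ CliqueChain f′ l′
  cliqueChain-≅ {f} {l} {f′} {l′} σ = φ , λ u v →
    sameCopy-⇔ u v ⊎-⇔ (bridge-⇔ u v ⊎-⇔ bridge-⇔ v u)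
    where
    π : Fin t → Permutation′ n
    π = proj₁ ∘ σ

    φ : (Fin t × Fin n) ↔ (Fin t × Fin n)
    φ = mk↔ₛ′ (λ { (i , x) → i , π i ⟨$⟩ʳ x })
              (λ { (i , y) → i , Inverse.from (π i) y })
              (λ { (i , y) → cong (i ,_) (Inverse.strictlyInverseˡ (π i) y) })
              (λ { (i , x) → cong (i ,_) (Inverse.strictlyInverseʳ (π i) x) })
    open Inverse φ using (to)

    sameCopy-⇔ : ∀ u v → SameCopy u v ⇔ SameCopy (to u) (to v)
    sameCopy-⇔ (i , x) (j , y) =
      mk⇔ (λ { (refl , x≢y) → refl , x≢y ∘ ⟨$⟩ʳ-injective (π i) })
          (λ { (refl , πx≢πy) → refl , πx≢πy ∘ cong (π i ⟨$⟩ʳ_) })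

    bridge-⇔ : ∀ u v → Bridge f l u v ⇔ Bridge f′ l′ (to u) (to v)
    bridge-⇔ (i , x) (j , y) =
      ⇔-id _ ×-⇔ ⟨$⟩ʳ-≡-⇔ (π i) (proj₂ (proj₂ (σ i))) ×-⇔ ⟨$⟩ʳ-≡-⇔ (π j) (proj₁ (proj₂ (σ j)))

module _ {t n k : ℕ} (e : Fin t → Fin (suc k) → Fin n) where

  entry exit : Fin t → Fin n
  entry i = e i zero
  exit  i = e i (fromℕ k)

  pathAligned≅cliqueChain : PathAligned t n (suc k) e ≅ CliqueChain t n entry exit
  pathAligned≅cliqueChain = ↔-id _ , λ u v → ⇔-id _ ⊎-⇔ (link-⇔ u v ⊎-⇔ link-⇔ v u)
    where
    link-⇔ : ∀ u v → Link t n (suc k) e u v ⇔ Bridge t n entry exit u v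
    link-⇔ (i , x) (j , y) =
      ⇔-id _ ×-⇔ Σ-toℕ≡-⇔ (fromℕ k) (toℕ-fromℕ k) ×-⇔ Σ-toℕ≡-⇔ zero refl

first≢last : ∀ {n k} (f : Fin (suc (suc k)) → Fin n) → Injective _≡_ _≡_ f →
  f zero ≢ f (fromℕ (suc k))
first≢last f f-injective first≡last with f-injective first≡last
... | ()

proposition6 : (t n : ℕ) → 2 ≤ t → 3 ≤ n →
    (ℓ ℓ′ : ℕ) → 2 ≤ ℓ → ℓ ≤ n → 2 ≤ ℓ′ → ℓ′ ≤ n →
    (e : Fin t → Fin ℓ → Fin n) → (∀ i → Injective _≡_ _≡_ (e i)) →
    (e′ : Fin t → Fin ℓ′ → Fin n) → (∀ i → Injective _≡_ _≡_ (e′ i)) →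
    PathAligned t n ℓ e ≅ PathAligned t n ℓ′ e′
proposition6 t n _ _ (suc (suc k)) (suc (suc k′)) (s≤s (s≤s _)) _ (s≤s (s≤s _)) _
             e e-injective e′ e′-injective =
  begin
    PathAligned t n _ e                   ≈⟨ pathAligned≅cliqueChain e ⟩
    CliqueChain t n (entry e) (exit e)    ≈⟨ cliqueChain-≅ t n σ ⟩
    CliqueChain t n (entry e′) (exit e′)  ≈⟨ pathAligned≅cliqueChain e′ ⟨
    PathAligned t n _ e′                  ∎
  where
  open SetoidReasoning ≅-setoid
  σ : ∀ i → Σ[ π ∈ Permutation′ n ] (π ⟨$⟩ʳ entry e i ≡ entry e′ i) × (π ⟨$⟩ʳ exit e i ≡ exit e′ i)
  σ i = permutation-mapping-pair (first≢last (e i) (e-injective i))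
                                 (first≢last (e′ i) (e′-injective i))
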